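{- Let $G$ be a connected graph with a set of cousins $C=\{\{v_1,v_2\},\{v_3,v_4\}\}$ such that $v_1v_3\notin E(G)$, $v_2v_4\notin E(G)$, for every $x\in N(v_1)\cap N(v_2)$ there exists $y\in N(v_3)\cap N(v_4)$ with $xy\in E(G)$, and for every $y\in N(v_3)\cap N(v_4)$ there exists $x\in N(v_1)\cap N(v_2)$ with $xy\in E(G)$. Then $d_{G+v_1v_3}(u,v)=d_G(u,v)=d_{G+v_2v_4}(u,v)$ for all $u\in U(C)$ and all $v\in V(G)$.
   Context: All graphs are finite, simple, undirected; $N(v)$ is the set of neighbors of $v$, $d_H(u,v)$ is the length of a shortest $u,v$-path in $H$, and $G+xy$ denotes $G$ with edge $xy$ added. Let $G$ be a connected graph of order at least five with distinct vertices $v_1,v_2,v_3,v_4$, $C=\{\{v_1,v_2\},\{v_3,v_4\}\}$ and $U(C)=V(G)\setminus\{v_1,v_2,v_3,v_4\}$; $C$ is a set of cousins in $G$ if (1) for all $u\in U(C)$, $d_G(u,v_1)=d_G(u,v_2)$ and $d_G(u,v_3)=d_G(u,v_4)$; and (2) $\sum_{u\in U(C)}d_G(u,v_1)=\sum_{u\in U(C)}d_G(u,v_3)$. -}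

module Defs where

open import Data.Nat using (ℕ; zero; suc; _+_; _≤_)
open import Data.Fin using (Fin)
open import Data.Sum using (_⊎_)
open import Data.Product using (_×_; ∃)
open import Relation.Nullary using (¬_; Dec; yes; no)
open import Relation.Binary.PropositionalEquality using (_≡_)
import Data.Fin as F

record Graph (n : ℕ) : Set₁ where
  field
    _~_    : Fin n → Fin n → Set
    ~-sym  : ∀ {x y} → x ~ y → y ~ x
    ~-irr  : ∀ {x} → ¬ (x ~ x)
open Graph public

data Walk {n : ℕ} (G : Graph n) : Fin n → Fin n → ℕ → Set where
  here : ∀ {u} → Walk G u u 0
  step : ∀ {u w v k} → _~_ G u w → Walk G w v k → Walk G u v (suc k)

IsDist : ∀ {n} → Graph n → Fin n → Fin n → ℕ → Set
IsDist G u v d = Walk G u v d × (∀ k → Walk G u v k → d ≤ k)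

Connected : ∀ {n} → Graph n → Set
Connected G = ∀ u v → ∃ λ k → Walk G u v k

addEdge : ∀ {n} → Graph n → (a b : Fin n) → ¬ (a ≡ b) → Graph n
addEdge {n} G a b a≢b = record { _~_ = R ; ~-sym = s ; ~-irr = i }
  where
  R : Fin n → Fin n → Set
  R x y = _~_ G x y ⊎ ((x ≡ a × y ≡ b) ⊎ (x ≡ b × y ≡ a))
  open import Data.Sum using (inj₁; inj₂)
  open import Data.Product using (_,_)
  open import Relation.Binary.PropositionalEquality using (refl; trans; sym)
  s : ∀ {x y} → R x y → R y x
  s (inj₁ e) = inj₁ (~-sym G e)
  s (inj₂ (inj₁ (p , q))) = inj₂ (inj₂ (q , p))
  s (inj₂ (inj₂ (p , q))) = inj₂ (inj₁ (q , p))
  i : ∀ {x} → ¬ R x x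
  i (inj₁ e) = ~-irr G e
  i (inj₂ (inj₁ (p , q))) = a≢b (trans (sym p) q)
  i (inj₂ (inj₂ (p , q))) = a≢b (trans (sym q) p)

sumFin : ∀ n → (Fin n → ℕ) → ℕ
sumFin zero f = 0
sumFin (suc n) f = f F.zero + sumFin n (λ i → f (F.suc i))

InU : ∀ {n} → (v₁ v₂ v₃ v₄ u : Fin n) → Set
InU v₁ v₂ v₃ v₄ u = ¬ (u ≡ v₁) × ¬ (u ≡ v₂) × ¬ (u ≡ v₃) × ¬ (u ≡ v₄)

sumU : ∀ {n} → (v₁ v₂ v₃ v₄ : Fin n) → (Fin n → ℕ) → ℕ
sumU {n} v₁ v₂ v₃ v₄ f = sumFin n g
  where
  g : Fin n → ℕ
  g u with u F.≟ v₁ | u F.≟ v₂ | u F.≟ v₃ | u F.≟ v₄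
  ... | no _ | no _ | no _ | no _ = f u
  ... | _ | _ | _ | _ = 0

Cousins : ∀ {n} → (d : Fin n → Fin n → ℕ) → (v₁ v₂ v₃ v₄ : Fin n) → Set
Cousins d v₁ v₂ v₃ v₄ =
  (∀ u → InU v₁ v₂ v₃ v₄ u → d u v₁ ≡ d u v₂ × d u v₃ ≡ d u v₄)
  × sumU v₁ v₂ v₃ v₄ (λ u → d u v₁) ≡ sumU v₁ v₂ v₃ v₄ (λ u → d u v₃)

-- Adding an edge ab leaves the distances from u unchanged as soon as d(u,a) and d(u,b)
-- differ by at most one: d(u,·) is then 1-Lipschitz along every edge of G + ab, so no
-- walk of G + ab from u to v is shorter than d(u,v).  For u ∈ U(C) the cousin condition
-- gives exactly this for v₁v₃ and v₂v₄.  Follow a shortest walk from u to v₁ (or v₃) up to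
-- its first vertex w adjacent to C: w sees some vᵢ, hence by the cousin condition both
-- vertices of that pair, hence by the matching hypotheses it is within distance 2 of both
-- v₁ and v₃.  So d(u,v₃) ≤ d(u,v₁) + 1, symmetrically, and the cousin condition transfers
-- this to v₂ and v₄.
module Submission where

open import Defs
open import Data.Nat using (ℕ; zero; suc; _+_; _≤_; z≤n; s≤s)
open import Data.Nat.Properties using (≤-trans; ≤-reflexive; +-identityʳ; +-suc; +-monoˡ-≤; n≤0⇒n≡0; m≤n⇒m≤1+n; module ≤-Reasoning)
open import Data.Fin using (Fin; _≟_)
open import Data.Product using (_×_; ∃; _,_; proj₁; proj₂)
open import Data.Sum using (_⊎_; inj₁; inj₂)
open import Data.Empty using (⊥-elim)
open import Relation.Nullary using (¬_; yes; no)
open import Relation.Binary.PropositionalEquality using (_≡_; refl; sym; trans; cong; subst)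

module Walks {n : ℕ} (G : Graph n) where

  _▷_ : ∀ {x y z k} → Walk G x y k → _~_ G y z → Walk G x z (suc k)
  here       ▷ e = step e here
  step e′ w  ▷ e = step e′ (w ▷ e)

  walk₀⇒≡ : ∀ {x y} → Walk G x y 0 → x ≡ y
  walk₀⇒≡ here = refl

  walk₁⇒adjacent : ∀ {x y} → Walk G x y 1 → _~_ G x y
  walk₁⇒adjacent (step e here) = e

  lift : ∀ {a b} (a≢b : ¬ a ≡ b) {x y k} → Walk G x y k → Walk (addEdge G a b a≢b) x y k
  lift a≢b here       = here
  lift a≢b (step e w) = step (inj₁ e) (lift a≢b w)

module Distance {n : ℕ} (G : Graph n) (d : Fin n → Fin n → ℕ)
  (dist : ∀ u v → IsDist G u v (d u v)) where

  open Walks G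

  shortest : ∀ u v → Walk G u v (d u v)
  shortest u v = proj₁ (dist u v)

  dist-≤-walk : ∀ {u v k} → Walk G u v k → d u v ≤ k
  dist-≤-walk {u} {v} = proj₂ (dist u v) _

  dist-self : ∀ u → d u u ≡ 0
  dist-self u = n≤0⇒n≡0 (dist-≤-walk here)

  dist-stepˡ : ∀ {x y v} → _~_ G x y → d x v ≤ suc (d y v)
  dist-stepˡ {y = y} {v} e = dist-≤-walk (step e (shortest y v))

  dist-stepʳ : ∀ {u x y} → _~_ G x y → d u y ≤ suc (d u x)
  dist-stepʳ {u} {x} e = dist-≤-walk (shortest u x ▷ e)

  adjacent⇒dist≡1 : ∀ {x y} → _~_ G x y → d x y ≡ 1
  adjacent⇒dist≡1 {x} {y} e with d x y | shortest x y | dist-≤-walk (step e here)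
  ... | zero  | w | _       = ⊥-elim (~-irr G (subst (_~_ G x) (sym (walk₀⇒≡ w)) e))
  ... | suc m | _ | s≤s m≤0 = cong suc (n≤0⇒n≡0 m≤0)

  dist≡1⇒adjacent : ∀ {x y} → d x y ≡ 1 → _~_ G x y
  dist≡1⇒adjacent {x} {y} eq = walk₁⇒adjacent (subst (Walk G x y) eq (shortest x y))

  adjacent-transfer : ∀ {x y z} → d x y ≡ d x z → _~_ G x y → _~_ G x z
  adjacent-transfer eq e = dist≡1⇒adjacent (trans (sym eq) (adjacent⇒dist≡1 e))

  module AddEdge (a b : Fin n) (a≢b : ¬ a ≡ b) (u : Fin n)
    (b≤1+a : d u b ≤ suc (d u a)) (a≤1+b : d u a ≤ suc (d u b)) where

    G′ : Graph n
    G′ = addEdge G a b a≢b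

    dist-stepʳ′ : ∀ {x y} → _~_ G′ x y → d u y ≤ suc (d u x)
    dist-stepʳ′ (inj₁ e)                    = dist-stepʳ e
    dist-stepʳ′ (inj₂ (inj₁ (refl , refl))) = b≤1+a
    dist-stepʳ′ (inj₂ (inj₂ (refl , refl))) = a≤1+b

    dist-≤-walk′ : ∀ {x v k} → Walk G′ x v k → d u v ≤ d u x + k
    dist-≤-walk′ {x} {v} here = ≤-reflexive (sym (+-identityʳ (d u v)))
    dist-≤-walk′ {x} (step {w = y} {k = k} e w) = begin
      d u _           ≤⟨ dist-≤-walk′ w ⟩
      d u y + k       ≤⟨ +-monoˡ-≤ k (dist-stepʳ′ e) ⟩
      suc (d u x + k) ≡⟨ sym (+-suc (d u x) k) ⟩
      d u x + suc k   ∎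
      where open ≤-Reasoning

    addEdge-preserves-dist : ∀ v → IsDist G′ u v (d u v)
    addEdge-preserves-dist v =
      lift a≢b (shortest u v) ,
      λ k w → subst (λ z → d u v ≤ z + k) (dist-self u) (dist-≤-walk′ w)

module CousinDistances {n : ℕ} (G : Graph n) (d : Fin n → Fin n → ℕ)
  (dist : ∀ u v → IsDist G u v (d u v)) (v₁ v₂ v₃ v₄ : Fin n)
  (cousins : ∀ u → InU v₁ v₂ v₃ v₄ u → d u v₁ ≡ d u v₂ × d u v₃ ≡ d u v₄)
  (match₁₂ : ∀ x → _~_ G x v₁ → _~_ G x v₂ → ∃ λ y → _~_ G y v₃ × _~_ G y v₄ × _~_ G x y)
  (match₃₄ : ∀ y → _~_ G y v₃ → _~_ G y v₄ → ∃ λ x → _~_ G x v₁ × _~_ G x v₂ × _~_ G x y)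
  where

  open Distance G d dist

  U : Fin n → Set
  U = InU v₁ v₂ v₃ v₄

  InC : Fin n → Set
  InC w = w ≡ v₁ ⊎ w ≡ v₂ ⊎ w ≡ v₃ ⊎ w ≡ v₄

  U-or-InC : ∀ w → U w ⊎ InC w
  U-or-InC w with w ≟ v₁ | w ≟ v₂ | w ≟ v₃ | w ≟ v₄
  ... | yes p | _     | _     | _     = inj₂ (inj₁ p)
  ... | no _  | yes p | _     | _     = inj₂ (inj₂ (inj₁ p))
  ... | no _  | no _  | yes p | _     = inj₂ (inj₂ (inj₂ (inj₁ p)))
  ... | no _  | no _  | no _  | yes p = inj₂ (inj₂ (inj₂ (inj₂ p)))
  ... | no ¬₁ | no ¬₂ | no ¬₃ | no ¬₄ = inj₁ (¬₁ , ¬₂ , ¬₃ , ¬₄)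

  ¬U-v₁ : ¬ U v₁
  ¬U-v₁ (v₁≢v₁ , _) = v₁≢v₁ refl

  ¬U-v₃ : ¬ U v₃
  ¬U-v₃ (_ , _ , v₃≢v₃ , _) = v₃≢v₃ refl

  adjacent-to-pair : ∀ {w c} → U w → _~_ G w c → InC c
    → (_~_ G w v₁ × _~_ G w v₂) ⊎ (_~_ G w v₃ × _~_ G w v₄)
  adjacent-to-pair {w} uw e (inj₁ refl) =
    inj₁ (e , adjacent-transfer (proj₁ (cousins w uw)) e)
  adjacent-to-pair {w} uw e (inj₂ (inj₁ refl)) =
    inj₁ (adjacent-transfer (sym (proj₁ (cousins w uw))) e , e)
  adjacent-to-pair {w} uw e (inj₂ (inj₂ (inj₁ refl))) =
    inj₂ (e , adjacent-transfer (proj₂ (cousins w uw)) e)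
  adjacent-to-pair {w} uw e (inj₂ (inj₂ (inj₂ refl))) =
    inj₂ (adjacent-transfer (sym (proj₂ (cousins w uw))) e , e)

  pair-neighbour-near : ∀ {w} → (_~_ G w v₁ × _~_ G w v₂) ⊎ (_~_ G w v₃ × _~_ G w v₄)
    → d w v₁ ≤ 2 × d w v₃ ≤ 2
  pair-neighbour-near {w} (inj₁ (w~v₁ , w~v₂)) with match₁₂ w w~v₁ w~v₂
  ... | y , y~v₃ , _ , w~y =
    m≤n⇒m≤1+n (dist-≤-walk (step w~v₁ here)) , dist-≤-walk (step w~y (step y~v₃ here))
  pair-neighbour-near {w} (inj₂ (w~v₃ , w~v₄)) with match₃₄ w w~v₃ w~v₄
  ... | x , x~v₁ , _ , x~w =
    dist-≤-walk (step (~-sym G x~w) (step x~v₁ here)) , m≤n⇒m≤1+n (dist-≤-walk (step w~v₃ here))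

  leaving-U : ∀ {w t k} → U w → ¬ U t → Walk G w t k → d w v₁ ≤ suc k × d w v₃ ≤ suc k
  leaving-U uw ¬ut here = ⊥-elim (¬ut uw)
  leaving-U uw ¬ut (step {w = c} e w) with U-or-InC c
  ... | inj₁ uc with leaving-U uc ¬ut w
  ...   | ≤₁ , ≤₃ = ≤-trans (dist-stepˡ e) (s≤s ≤₁) , ≤-trans (dist-stepˡ e) (s≤s ≤₃)
  leaving-U {k = suc k} uw ¬ut (step e w) | inj₂ c∈C
    with pair-neighbour-near (adjacent-to-pair uw e c∈C)
  ... | ≤₁ , ≤₃ = ≤-trans ≤₁ (s≤s (s≤s z≤n)) , ≤-trans ≤₃ (s≤s (s≤s z≤n))

  d₃≤1+d₁ : ∀ {u} → U u → d u v₃ ≤ suc (d u v₁)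
  d₃≤1+d₁ {u} uu = proj₂ (leaving-U uu ¬U-v₁ (shortest u v₁))

  d₁≤1+d₃ : ∀ {u} → U u → d u v₁ ≤ suc (d u v₃)
  d₁≤1+d₃ {u} uu = proj₁ (leaving-U uu ¬U-v₃ (shortest u v₃))

  d₄≤1+d₂ : ∀ {u} → U u → d u v₄ ≤ suc (d u v₂)
  d₄≤1+d₂ {u} uu with cousins u uu | d₃≤1+d₁ uu
  ... | d₁≡d₂ , d₃≡d₄ | ≤₃ rewrite d₁≡d₂ | d₃≡d₄ = ≤₃

  d₂≤1+d₄ : ∀ {u} → U u → d u v₂ ≤ suc (d u v₄)
  d₂≤1+d₄ {u} uu with cousins u uu | d₁≤1+d₃ uu
  ... | d₁≡d₂ , d₃≡d₄ | ≤₁ rewrite d₁≡d₂ | d₃≡d₄ = ≤₁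

-- Only condition (1) of the cousin definition and the two matching hypotheses are needed;
-- connectivity, the order bound, the sum condition and v₁v₃, v₂v₄ ∉ E(G) are not.
lemma3p10 : (n : ℕ) → 5 ≤ n → (G : Graph n) → Connected G
    → (d : Fin n → Fin n → ℕ) → (∀ u v → IsDist G u v (d u v))
    → (v₁ v₂ v₃ v₄ : Fin n)
    → ¬ (v₁ ≡ v₂) → (v₁≢v₃ : ¬ (v₁ ≡ v₃)) → ¬ (v₁ ≡ v₄) → ¬ (v₂ ≡ v₃) → (v₂≢v₄ : ¬ (v₂ ≡ v₄)) → ¬ (v₃ ≡ v₄)
    → Cousins d v₁ v₂ v₃ v₄
    → ¬ (_~_ G v₁ v₃) → ¬ (_~_ G v₂ v₄)
    → (∀ x → _~_ G x v₁ → _~_ G x v₂ → ∃ λ y → _~_ G y v₃ × _~_ G y v₄ × _~_ G x y)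
    → (∀ y → _~_ G y v₃ → _~_ G y v₄ → ∃ λ x → _~_ G x v₁ × _~_ G x v₂ × _~_ G x y)
    → ∀ u v → InU v₁ v₂ v₃ v₄ u
    → IsDist (addEdge G v₁ v₃ v₁≢v₃) u v (d u v) × IsDist (addEdge G v₂ v₄ v₂≢v₄) u v (d u v)
lemma3p10 n _ G _ d dist v₁ v₂ v₃ v₄ _ v₁≢v₃ _ _ v₂≢v₄ _ (cousins , _) _ _ match₁₂ match₃₄ u v uu =
  AddEdge.addEdge-preserves-dist v₁ v₃ v₁≢v₃ u (d₃≤1+d₁ uu) (d₁≤1+d₃ uu) v ,
  AddEdge.addEdge-preserves-dist v₂ v₄ v₂≢v₄ u (d₄≤1+d₂ uu) (d₂≤1+d₄ uu) v
  where
  open Distance G d dist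
  open CousinDistances G d dist v₁ v₂ v₃ v₄ cousins match₁₂ match₃₄
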